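{- Let $n>1$ and let $\alpha_n$ be the $\omega$-word defined below. Then $\alpha_n\notin\mathcal{L}(\mathcal{FB}_n)$.
   Context: For $n>1$, $\mathcal{FB}_n$ is the full Büchi automaton with states $S_n=\{s_0,\dots,s_{n-2},s_f\}$, $I_n=S'_n=\{s_0,\dots,s_{n-2}\}$, $F_n=\{s_f\}$, alphabet $\Sigma_n=\mathcal{P}(S_n\times S_n)$ and transitions $\langle p,a,q\rangle\in\Delta_n$ iff $\langle p,q\rangle\in a$; a run over an $\omega$-word $\alpha$ is a state sequence $\rho(0)\rho(1)\cdots$ with $\rho(0)\in I_n$ and $\langle\rho(i),\alpha(i),\rho(i+1)\rangle\in\Delta_n$; $\mathcal{L}(\mathcal{FB}_n)$ is the set of $\omega$-words having a run visiting $s_f$ infinitely often. A $Q(m)$-ranking ($1\le m<n$) is a function $h:S'_n\to\{0,\dots,2m-1\}$ attaining every odd value $1,3,\dots,2m-1$. $L(n,m)$ is the number of $Q(m)$-rankings and $L(n)=\max_{1\le m<n}L(n,m)$. Words $w_{f,g}$: for a $Q(m)$-ranking $h$, $Rank_h(r)=\{q\in S'_n:h(q)=r\}$. For $T\subseteq S'_n$: $Id(T)=\{\langle q,q\rangle:q\in T\}$, $TtoF(T)=Id(S'_n)\cup\{\langle q,s_f\rangle:q\in T\}$, $FtoT(T)=Id(S'_n)\cup\{\langle s_f,q\rangle:q\in T\}$; $c(f,g)=\{\langle p,q\rangle\in S'_n\times S'_n:f(p)=g(q)\text{ odd}\}$; $d(h,r,r')=TtoF(Rank_h(r))\cdot FtoT(Rank_h(r'))$;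 if $r_1>\dots>r_k$ are the values of $h$, $u_h=d(h,r_1,r_2)\cdots d(h,r_{k-1},r_k)$; $w_{f,g}=u_f\cdot c(f,g)\cdot u_g$. The word $\alpha_n$: fix $m$ with $L(n,m)=L(n)$, write $L=L(n)$, and fix an infinite sequence $f_0,f_1,\dots$ of $Q(m)$-rankings such that $f_i\neq f_j$ for all distinct $0\le i,j<L$ and $f_{jL+i}=f_i$ for all $i,j\ge0$. Then $\alpha_n=w_0w_1w_2\cdots$ with $w_i=w_{f_i,f_{i+1}}$. -}

module Defs where

open import Data.Bool using (Bool; true; false; _∧_; if_then_else_)
open import Data.Nat using (ℕ; zero; suc; _+_; _*_; _∸_; _<_; _≤_; _≡ᵇ_; _%_; _<?_; pred)
import Data.Nat.Properties as ℕP
open import Data.Nat.Base using (_⊔_)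
open import Data.Fin using (Fin; toℕ)
import Data.Fin.Properties as FinP
open import Data.List using (List; []; _∷_; map; concatMap; filter; length; upTo; downFrom; foldr)
open import Data.List.NonEmpty using (List⁺; _∷_; _++⁺_; toList)
open import Data.Vec using (Vec; lookup) renaming ([] to []ᵥ; _∷_ to _∷ᵥ_)
open import Data.Vec.Relation.Unary.All using (All)
import Data.Vec.Relation.Unary.All as VAll
open import Data.Vec.Relation.Unary.Any using (Any)
import Data.Vec.Relation.Unary.Any as VAny
open import Data.Product using (Σ; ∃; _×_; _,_)
open import Relation.Binary.PropositionalEquality using (_≡_)
open import Relation.Nullary using (Dec; ¬_)
open import Relation.Nullary.Decidable using (⌊_⌋; _×-dec_)

-- The full Büchi automaton FB_n.  We write k = n ∸ 1; the states
-- s_0,…,s_{n-2} are  st q  (q : Fin k) and s_f is  sf.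

data State (n : ℕ) : Set where
  st : Fin (pred n) → State n
  sf : State n

-- A letter of Σ_n = P(S_n × S_n), as a (decidable) relation on states.
Letter : ℕ → Set
Letter n = State n → State n → Bool

ωWord : ℕ → Set
ωWord n = ℕ → Letter n

-- Transitions: ⟨p,a,q⟩ ∈ Δ_n iff ⟨p,q⟩ ∈ a.  A run over α, starting in I_n.
IsRun : (n : ℕ) → ωWord n → (ℕ → State n) → Set
IsRun n α ρ = (∃ λ q → ρ 0 ≡ st q) × (∀ i → α i (ρ i) (ρ (suc i)) ≡ true)

Accepted : (n : ℕ) → ωWord n → Set
Accepted n α = ∃ λ (ρ : ℕ → State n) →
  IsRun n α ρ × (∀ i → ∃ λ j → i ≤ j × ρ j ≡ sf)

-- Q(m)-rankings h : S'_n → {0,…,2m-1}, represented as vectors of length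
-- n ∸ 1 (h(s_q) = lookup h q), attaining every odd value 1,3,…,2m-1.

Ranking : ℕ → Set
Ranking n = Vec ℕ (pred n)

IsQRanking : (n m : ℕ) → Ranking n → Set
IsQRanking n m h = All (λ v → v < 2 * m) h × (∀ (j : Fin m) → Any (λ v → v ≡ 2 * toℕ j + 1) h)

isQRanking? : (n m : ℕ) (h : Ranking n) → Dec (IsQRanking n m h)
isQRanking? n m h =
  VAll.all? (λ v → v <? 2 * m) h ×-dec
  FinP.all? (λ j → VAny.any? (λ v → v ℕP.≟ 2 * toℕ j + 1) h)

allVecs : ℕ → (k : ℕ) → List (Vec ℕ k)
allVecs b zero = []ᵥ ∷ []
allVecs b (suc k) = concatMap (λ x → map (x ∷ᵥ_) (allVecs b k)) (upTo b)

L : ℕ → ℕ → ℕ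
L n m = length (filter (isQRanking? n m) (allVecs (2 * m) (pred n)))

Lmax : ℕ → ℕ
Lmax n = foldr _⊔_ 0 (map (λ i → L n (suc i)) (upTo (pred n)))

eqFin : ∀ {k} → Fin k → Fin k → Bool
eqFin p q = ⌊ p FinP.≟ q ⌋

inRank : ∀ {n} → Ranking n → ℕ → Fin (pred n) → Bool
inRank h r q = lookup h q ≡ᵇ r

TtoF : ∀ {n} → (Fin (pred n) → Bool) → Letter n
TtoF T (st p) (st q) = eqFin p q
TtoF T (st p) sf     = T p
TtoF T sf     _      = false

FtoT : ∀ {n} → (Fin (pred n) → Bool) → Letter n
FtoT T (st p) (st q) = eqFin p q
FtoT T sf     (st q) = T q
FtoT T _      _      = false

isOdd : ℕ → Bool
isOdd v = (v % 2) ≡ᵇ 1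

cLetter : ∀ {n} → Ranking n → Ranking n → Letter n
cLetter f g (st p) (st q) = (lookup f p ≡ᵇ lookup g q) ∧ isOdd (lookup f p)
cLetter f g _      _      = false

d : ∀ {n} → Ranking n → ℕ → ℕ → List (Letter n)
d {n} h r r' = TtoF {n} (inRank {n} h r) ∷ FtoT {n} (inRank {n} h r') ∷ []

maxVal : ∀ {k} → Vec ℕ k → ℕ
maxVal []ᵥ = 0
maxVal (x ∷ᵥ xs) = x ⊔ maxVal xs

values : ∀ {n} → Ranking n → List ℕ
values h = filter (λ r → VAny.any? (λ v → v ℕP.≟ r) h) (downFrom (suc (maxVal h)))

chain : ∀ {n} → Ranking n → List ℕ → List (Letter n)
chain {n} h (r ∷ rest@(r' ∷ _)) = d {n} h r r' Data.List.++ chain {n} h rest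
chain h _ = []

u : ∀ {n} → Ranking n → List (Letter n)
u {n} h = chain {n} h (values {n} h)

w : ∀ {n} → Ranking n → Ranking n → List⁺ (Letter n)
w {n} f g = u {n} f ++⁺ (cLetter {n} f g ∷ u {n} g)

flattenFrom : ∀ {A : Set} → (ℕ → List⁺ A) → ℕ → List⁺ A → ℕ → A
flattenFrom ws i (x ∷ xs) zero = x
flattenFrom ws i (x ∷ (y ∷ ys)) (suc p) = flattenFrom ws i (y ∷ ys) p
flattenFrom ws i (x ∷ []) (suc p) = flattenFrom ws (suc i) (ws (suc i)) p

flatten : ∀ {A : Set} → (ℕ → List⁺ A) → ℕ → A
flatten ws = flattenFrom ws 0 (ws 0)

alpha : (n : ℕ) → (ℕ → Ranking n) → ωWord n
alpha n f = flatten (λ i → w {n} (f i) (f (suc i)))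

module Submission where

-- The word α_n is rejected by FB_n because it carries a *potential*: a
-- bound on a natural-number measure of the current state, attached to
-- every position of α_n, which no run can increase and which every visit
-- to s_f strictly decreases.  Since natural numbers cannot decrease
-- infinitely often, no run visits s_f infinitely often.
--
-- The argument works for every sequence of rankings.

open import Defs
open import Data.Nat using (ℕ; _<_; _≤_; _*_; _+_)
open import Relation.Binary.PropositionalEquality using (_≡_; _≢_)
open import Relation.Nullary using (¬_)

open import Data.Nat using (zero; suc; _>_; _≡ᵇ_; _≤′_; ≤′-refl; ≤′-step; s≤s)
open import Data.Nat.Properties
  using (≤-refl; ≤-trans; ≤-reflexive; <-≤-trans; <-trans; n<1+n; m≤n+m; ≤⇒≤′; ≡ᵇ⇒≡; _≟_)
open import Data.Bool using (true; T)
open import Data.Bool.Properties using (T-≡; T-∧)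
open import Data.Empty using (⊥)
open import Data.Fin using (Fin)
open import Data.List using (List; []; _∷_)
open import Data.List.NonEmpty using (List⁺; _∷_; _++⁺_; toList)
open import Data.List.Relation.Unary.Linked using (Linked; []; [-]; _∷_)
open import Data.List.Relation.Unary.Linked.Properties using (applyDownFrom⁺₂; filter⁺)
open import Data.Vec using (lookup)
import Data.Vec.Relation.Unary.Any as VAny
open import Data.Product using (∃; _×_; _,_; proj₁)
open import Function.Bundles using (module Equivalence)
open import Relation.Binary.PropositionalEquality using (refl; sym; subst)
open import Relation.Nullary.Decidable using (toWitness)

noInfiniteDescent : (G : ℕ → ℕ) (P : ℕ → Set) →
  (∀ i → G (suc i) ≤ G i) → (∀ i → P (suc i) → G (suc i) < G i) →
  ¬ (∀ i → ∃ λ j → i ≤ j × P j)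
noInfiniteDescent G P nonincreasing strict often = bounded (suc (G 0)) 0 (n<1+n (G 0))
  where
  antitone : ∀ {i j} → i ≤′ j → G j ≤ G i
  antitone ≤′-refl = ≤-refl
  antitone (≤′-step i≤j) = ≤-trans (nonincreasing _) (antitone i≤j)

  -- each later P-position lowers the bound on G by one
  bounded : ∀ v i → G i < v → ⊥
  bounded (suc v) i (s≤s Gi≤v) with often (suc i)
  ... | suc j , s≤s i≤j , Pj =
    bounded v (suc j) (<-≤-trans (strict j Pj) (≤-trans (antitone (≤⇒≤′ i≤j)) Gi≤v))

module LabelledPaths {A P : Set} (Step : P → A → P → Set) where

  infixr 5 _∷_ _++ᴾ_

  data Path : P → List A → P → Set where
    []  : ∀ {p} → Path p [] p
    _∷_ : ∀ {p a q as r} → Step p a q → Path q as r → Path p (a ∷ as) r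

  _++ᴾ_ : ∀ {p xs q} {ys : List⁺ A} {r} →
    Path p xs q → Path q (toList ys) r → Path p (toList (xs ++⁺ ys)) r
  [] ++ᴾ path = path
  (s ∷ path) ++ᴾ path' = s ∷ (path ++ᴾ path')

  InfinitePath : (ℕ → A) → Set
  InfinitePath α = ∃ λ (Γ : ℕ → P) → ∀ k → Step (Γ k) (α k) (Γ (suc k))

  glue : (ws : ℕ → List⁺ A) (Π : ℕ → P) →
    (∀ i → Path (Π i) (toList (ws i)) (Π (suc i))) → InfinitePath (flatten ws)
  glue ws Π paths = stateFrom 0 (ws 0) (paths 0) , stepFrom 0 (ws 0) (paths 0)
    where
    -- the k-th state, starting inside block i at its remaining suffix xs
    stateFrom : ∀ i (xs : List⁺ A) {p} → Path p (toList xs) (Π (suc i)) → ℕ → P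
    stateFrom i xs {p} _ zero = p
    stateFrom i (x ∷ []) _ (suc k) = stateFrom (suc i) (ws (suc i)) (paths (suc i)) k
    stateFrom i (x ∷ y ∷ ys) (_ ∷ path) (suc k) = stateFrom i (y ∷ ys) path k

    stepFrom : ∀ i (xs : List⁺ A) {p} (path : Path p (toList xs) (Π (suc i))) k →
      Step (stateFrom i xs path k) (flattenFrom ws i xs k) (stateFrom i xs path (suc k))
    stepFrom i (x ∷ []) (s ∷ []) zero = s
    stepFrom i (x ∷ y ∷ ys) (s ∷ _) zero = s
    stepFrom i (x ∷ []) (_ ∷ []) (suc k) = stepFrom (suc i) (ws (suc i)) (paths (suc i)) k
    stepFrom i (x ∷ y ∷ ys) (_ ∷ path) (suc k) = stepFrom i (y ∷ ys) path k

fromTrue : ∀ {b} → b ≡ true → T b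
fromTrue = Equivalence.from T-≡

≡ᵇ-sound : ∀ {x y} → (x ≡ᵇ y) ≡ true → x ≡ y
≡ᵇ-sound {x} {y} e = ≡ᵇ⇒≡ x y (fromTrue e)

eqFin-sound : ∀ {k} {p q : Fin k} → eqFin p q ≡ true → p ≡ q
eqFin-sound e = toWitness (fromTrue e)

module _ {n : ℕ} where

  Potential : Set
  Potential = State n → ℕ

  acceptance : State n → ℕ
  acceptance (st _) = 0
  acceptance sf = 1

  Decreases : Potential → Letter n → Potential → Set
  Decreases π a π' = ∀ s t → a s t ≡ true → acceptance t + π' t ≤ π s

  open LabelledPaths Decreases

  -- An ω-word carrying an infinite path of decreasing potentials is
  -- rejected: along a run the potentials of the visited states form a
  -- nonincreasing sequence that drops at every visit to s_f.
  rejected : (α : ωWord n) → InfinitePath α → ¬ Accepted n α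
  rejected α (Γ , decreasing) (ρ , (_ , run) , often) =
    noInfiniteDescent G (λ j → ρ j ≡ sf) nonincreasing strict often
    where
    G : ℕ → ℕ
    G i = Γ i (ρ i)

    along : ∀ i → acceptance (ρ (suc i)) + G (suc i) ≤ G i
    along i = decreasing i (ρ i) (ρ (suc i)) (run i)

    nonincreasing : ∀ i → G (suc i) ≤ G i
    nonincreasing i = ≤-trans (m≤n+m (G (suc i)) _) (along i)

    strict : ∀ i → ρ (suc i) ≡ sf → G (suc i) < G i
    strict i e = subst (λ q → acceptance q + G (suc i) ≤ G i) e (along i)

  rankPotential : Ranking n → ℕ → Potential
  rankPotential h v (st q) = lookup h q
  rankPotential h v sf = v

  -- TtoF(Rank_h(r)) moves from rank r to s_f, so it decreases the
  -- potential of h to any value r' below r on s_f.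
  TtoF-decreases : ∀ h {r r'} → r' < r →
    Decreases (rankPotential h 0) (TtoF {n} (inRank {n} h r)) (rankPotential h r')
  TtoF-decreases h r'<r (st p) (st q) e with eqFin-sound e
  ... | refl = ≤-refl
  TtoF-decreases h {r' = r'} r'<r (st p) sf e = subst (r' <_) (sym (≡ᵇ-sound e)) r'<r

  -- FtoT(Rank_h(r')) leaves s_f only into rank r'.
  FtoT-decreases : ∀ h {r'} →
    Decreases (rankPotential h r') (FtoT {n} (inRank {n} h r')) (rankPotential h 0)
  FtoT-decreases h (st p) (st q) e with eqFin-sound e
  ... | refl = ≤-refl
  FtoT-decreases h sf (st q) e = ≤-reflexive (≡ᵇ-sound e)

  -- c(f,g) connects p to q only when f(p) = g(q).
  c-decreases : ∀ f g → Decreases (rankPotential f 0) (cLetter {n} f g) (rankPotential g 0)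
  c-decreases f g (st p) (st q) e =
    ≤-reflexive (sym (≡ᵇ⇒≡ _ _ (proj₁ (Equivalence.to T-∧ (fromTrue e)))))

  chain-path : ∀ h {l} → Linked _>_ l →
    Path (rankPotential h 0) (chain {n} h l) (rankPotential h 0)
  chain-path h [] = []
  chain-path h [-] = []
  chain-path h (r>r' ∷ rest) = TtoF-decreases h r>r' ∷ FtoT-decreases h ∷ chain-path h rest

  values-decreasing : ∀ h → Linked _>_ (values {n} h)
  values-decreasing h =
    filter⁺ (λ r → VAny.any? (λ v → v ≟ r) h) (λ p q → <-trans q p)
      (applyDownFrom⁺₂ (λ i → i) _ n<1+n)

  w-path : ∀ f g → Path (rankPotential f 0) (toList (w {n} f g)) (rankPotential g 0)
  w-path f g = u-path f ++ᴾ c-decreases f g ∷ u-path g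
    where
    u-path : ∀ h → Path (rankPotential h 0) (u {n} h) (rankPotential h 0)
    u-path h = chain-path h (values-decreasing h)

  alpha-path : (f : ℕ → Ranking n) → LabelledPaths.InfinitePath Decreases (alpha n f)
  alpha-path f = glue (λ i → w {n} (f i) (f (suc i))) (λ i → rankPotential (f i) 0)
    (λ i → w-path (f i) (f (suc i)))

lemma4p5 : (n : ℕ) → 1 < n →
    (m : ℕ) → 1 ≤ m → m < n → L n m ≡ Lmax n →
    (f : ℕ → Ranking n) →
    (∀ i → IsQRanking n m (f i)) →
    (∀ i j → i < Lmax n → j < Lmax n → i ≢ j → f i ≢ f j) →
    (∀ i j → f (j * Lmax n + i) ≡ f i) →
    ¬ Accepted n (alpha n f)
lemma4p5 n _ m _ _ _ f _ _ _ = rejected (alpha n f) (alpha-path f)
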